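{- Let $L_1,L_2$ be languages (where $L_2$ consists of pairs of strings). If $L_1$ split-hide reduces to $L_2$ and $L_2$ has an efficient BSM protocol, then $L_1$ has an efficient instance hiding scheme with a single nonadaptive pair of queries.
   Context: A split-hide reduction from $L_1$ to $L_2$ is a pair of polynomial-time computable randomized mappings $a,b\colon\{0,1\}^n\to\{0,1\}^{\mathrm{poly}(n)}$ (computed from $x$ and a common random string) such that (correctness) for every choice of randomness, $x\in L_1$ iff $(a(x),b(x))\in L_2$; and (privacy) the marginal distribution of $a(x)$ and the marginal distribution of $b(x)$ each depend only on $|x|$. A BSM protocol for a language $L_2$ of pairs consists of arbitrary functions $A$ (Alice), $B$ (Bob) and Boolean circuits $C$ (Carol), one per input size, with $C(A(u),B(v))=1$ iff $(u,v)\in L_2$; it is efficient if Carol's size is polynomial in the input size. A two-query instance hiding scheme for $L_1$: a randomized circuit family (Henry) that on input $z\in\{0,1\}^n$ and randomness $r$ makes one query to each of two oracles (arbitrary functions), nonadaptively, and outputs whether $z\in L_1$ correctly for every $r$, such that the distribution of each query separately depends only on $n$; efficient if Henry's size is polynomial in $n$. -}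

module Defs where

open import Data.Bool using (Bool; true; false; _∧_; _∨_; not)
open import Data.Bool.Properties using () renaming (_≟_ to _≟ᵇ_)
open import Data.Nat using (ℕ; zero; suc; _+_; _*_; _^_; _≤_)
open import Data.Fin using (Fin)
open import Data.Vec using (Vec; []; _∷_; lookup; map; _++_; head)
open import Data.Vec.Properties using (≡-dec)
open import Data.List using (List; length; filter; concatMap) renaming ([] to []ˡ; _∷_ to _∷ˡ_; map to mapˡ)
open import Data.Product using (Σ; _×_)
open import Relation.Binary.PropositionalEquality using (_≡_)

Bits : ℕ → Set
Bits = Vec Bool

Language : Set
Language = (n : ℕ) → Bits n → Bool

PairLanguage : Set
PairLanguage = (p q : ℕ) → Bits p → Bits q → Bool

PolyBounded : (ℕ → ℕ) → Set
PolyBounded f = Σ ℕ λ c → ∀ n → f n ≤ c * (n ^ c) + c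

-- A circuit over w available wires; each gate adds one new wire
-- (placed at the front, index 0); finally outputs are selected wires.

data Gate (w : ℕ) : Set where
  AND OR : Fin w → Fin w → Gate w
  NOT    : Fin w → Gate w
  CONST  : Bool → Gate w

evalGate : ∀ {w} → Gate w → Bits w → Bool
evalGate (AND i j) x = lookup x i ∧ lookup x j
evalGate (OR i j)  x = lookup x i ∨ lookup x j
evalGate (NOT i)   x = not (lookup x i)
evalGate (CONST b) x = b

data Circuit (w m : ℕ) : Set where
  output : Vec (Fin w) m → Circuit w m
  gate   : Gate w → Circuit (suc w) m → Circuit w m

eval : ∀ {w m} → Circuit w m → Bits w → Bits m
eval (output o) x = map (lookup x) o
eval (gate g c) x = eval c (evalGate g x ∷ x)

size : ∀ {w m} → Circuit w m → ℕ
size (output _) = 0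
size (gate _ c) = suc (size c)

-- Uniform distributions over random strings, via counting.

allBits : (m : ℕ) → List (Bits m)
allBits zero    = [] ∷ˡ []ˡ
allBits (suc m) = concatMap (λ r → (false ∷ r) ∷ˡ (true ∷ r) ∷ˡ []ˡ) (allBits m)

count : ∀ {m k} → (Bits m → Bits k) → Bits k → ℕ
count {m} f y = length (filter (λ r → ≡-dec _≟ᵇ_ (f r) y) (allBits m))

SameDist : ∀ {m k} → (Bits m → Bits k) → (Bits m → Bits k) → Set
SameDist f g = ∀ y → count f y ≡ count g y

-- Split-hide reduction from L₁ to L₂.
-- The polynomial-time computable randomized mappings a, b are modelled as
-- polynomial-size circuit families taking (x , r), r the common random string.

record SplitHide (L₁ : Language) (L₂ : PairLanguage) : Set where
  field
    ρ  : ℕ → ℕ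
    pa : ℕ → ℕ
    pb : ℕ → ℕ
    ρ-poly  : PolyBounded ρ
    pa-poly : PolyBounded pa
    pb-poly : PolyBounded pb
    A : (n : ℕ) → Circuit (n + ρ n) (pa n)
    B : (n : ℕ) → Circuit (n + ρ n) (pb n)
    A-poly : PolyBounded (λ n → size (A n))
    B-poly : PolyBounded (λ n → size (B n))
  a : (n : ℕ) → Bits n → Bits (ρ n) → Bits (pa n)
  a n x r = eval (A n) (x ++ r)
  b : (n : ℕ) → Bits n → Bits (ρ n) → Bits (pb n)
  b n x r = eval (B n) (x ++ r)
  field
    correct : ∀ n (x : Bits n) (r : Bits (ρ n)) →
              L₁ n x ≡ L₂ (pa n) (pb n) (a n x r) (b n x r)
    privateA : ∀ n (x x′ : Bits n) → SameDist (a n x) (a n x′)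
    privateB : ∀ n (x x′ : Bits n) → SameDist (b n x) (b n x′)

-- Efficient BSM protocol for a pair language L₂
-- (one Alice / Bob / Carol per input size, i.e. per pair of lengths (p , q)).

record EfficientBSM (L₂ : PairLanguage) : Set where
  field
    mA : ℕ → ℕ → ℕ
    mB : ℕ → ℕ → ℕ
    Alice : (p q : ℕ) → Bits p → Bits (mA p q)
    Bob   : (p q : ℕ) → Bits q → Bits (mB p q)
    Carol : (p q : ℕ) → Circuit (mA p q + mB p q) 1
    correct : ∀ p q (u : Bits p) (v : Bits q) →
              head (eval (Carol p q) (Alice p q u ++ Bob p q v)) ≡ L₂ p q u v
    efficient : Σ ℕ λ c → ∀ p q → size (Carol p q) ≤ c * ((p + q) ^ c) + c

-- Henry = (query circuit QA, query circuit QB, decision circuit D), all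
-- reading the input z and randomness r; D also reads the two oracle answers.

record EfficientIH (L₁ : Language) : Set where
  field
    ρ  : ℕ → ℕ
    ℓa : ℕ → ℕ
    ℓb : ℕ → ℕ
    ka : ℕ → ℕ
    kb : ℕ → ℕ
    ρ-poly  : PolyBounded ρ
    ℓa-poly : PolyBounded ℓa
    ℓb-poly : PolyBounded ℓb
    OA : (n : ℕ) → Bits (ℓa n) → Bits (ka n)   -- arbitrary oracle functions
    OB : (n : ℕ) → Bits (ℓb n) → Bits (kb n)
    QA : (n : ℕ) → Circuit (n + ρ n) (ℓa n)
    QB : (n : ℕ) → Circuit (n + ρ n) (ℓb n)
    D  : (n : ℕ) → Circuit ((n + ρ n) + (ka n + kb n)) 1
    efficient : PolyBounded (λ n → size (QA n) + size (QB n) + size (D n))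
  qa : (n : ℕ) → Bits n → Bits (ρ n) → Bits (ℓa n)
  qa n z r = eval (QA n) (z ++ r)
  qb : (n : ℕ) → Bits n → Bits (ρ n) → Bits (ℓb n)
  qb n z r = eval (QB n) (z ++ r)
  field
    correct : ∀ n (z : Bits n) (r : Bits (ρ n)) →
              head (eval (D n) ((z ++ r) ++ (OA n (qa n z r) ++ OB n (qb n z r)))) ≡ L₁ n z
    privateA : ∀ n (z z′ : Bits n) → SameDist (qa n z) (qa n z′)
    privateB : ∀ n (z z′ : Bits n) → SameDist (qb n z) (qb n z′)

{-# OPTIONS --safe #-}
-- Henry queries the first oracle at a(z, r) and the second at b(z, r), the two halves of the
-- split-hide reduction, so each query on its own is distributed independently of z.  The
-- oracles are Alice and Bob of the BSM protocol, and Henry's decision is Carol run on their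
-- messages: Carol accepts exactly when (a(z, r), b(z, r)) ∈ L₂, i.e. when z ∈ L₁.  Henry's
-- size is polynomial because Carol is polynomial in |a(z, r)| + |b(z, r)|, itself polynomial in n.
module Submission where

open import Defs
open import Data.Bool using (_∧_; _∨_; not)
open import Data.Nat using (ℕ; zero; suc; _+_; _*_; _^_; _≤_; z≤n)
open import Data.Nat.Properties
open import Data.Fin using (Fin; zero; suc; _↑ʳ_; lift)
open import Data.Vec using (_∷_; lookup; map; _++_; head)
open import Data.Vec.Properties using (map-∘; map-cong; lookup-++ʳ)
open import Data.Product using (Σ; _,_)
open import Algebra.Properties.CommutativeSemigroup *-commutativeSemigroup using (interchange)
open import Relation.Binary.PropositionalEquality using (_≡_; refl; sym; trans; cong; cong₂; module ≡-Reasoning)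

renameGate : ∀ {w w′} → (Fin w → Fin w′) → Gate w → Gate w′
renameGate f (AND i j) = AND (f i) (f j)
renameGate f (OR i j)  = OR (f i) (f j)
renameGate f (NOT i)   = NOT (f i)
renameGate f (CONST b) = CONST b

rename : ∀ {w w′ m} → (Fin w → Fin w′) → Circuit w m → Circuit w′ m
rename f (output o) = output (map f o)
rename f (gate g c) = gate (renameGate f g) (rename (lift 1 f) c)

size-rename : ∀ {w w′ m} (f : Fin w → Fin w′) (c : Circuit w m) → size (rename f c) ≡ size c
size-rename f (output o) = refl
size-rename f (gate g c) = cong suc (size-rename (lift 1 f) c)

evalGate-rename : ∀ {w w′} (f : Fin w → Fin w′) (g : Gate w) {x : Bits w} {y : Bits w′} →
                  (∀ i → lookup y (f i) ≡ lookup x i) → evalGate (renameGate f g) y ≡ evalGate g x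
evalGate-rename f (AND i j) y∘f≗x = cong₂ _∧_ (y∘f≗x i) (y∘f≗x j)
evalGate-rename f (OR i j)  y∘f≗x = cong₂ _∨_ (y∘f≗x i) (y∘f≗x j)
evalGate-rename f (NOT i)   y∘f≗x = cong not (y∘f≗x i)
evalGate-rename f (CONST b) y∘f≗x = refl

eval-rename : ∀ {w w′ m} (f : Fin w → Fin w′) (c : Circuit w m) {x : Bits w} {y : Bits w′} →
              (∀ i → lookup y (f i) ≡ lookup x i) → eval (rename f c) y ≡ eval c x
eval-rename f (output o) y∘f≗x = trans (sym (map-∘ _ f o)) (map-cong y∘f≗x o)
eval-rename f (gate g c) {x} {y} y∘f≗x =
  trans (cong (λ v → eval (rename (lift 1 f) c) (v ∷ y)) (evalGate-rename f g y∘f≗x))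
        (eval-rename (lift 1 f) c extended)
  where
  extended : ∀ i → lookup (evalGate g x ∷ y) (lift 1 f i) ≡ lookup (evalGate g x ∷ x) i
  extended zero    = refl
  extended (suc i) = y∘f≗x i

weakenˡ : ∀ {w m} k → Circuit w m → Circuit (k + w) m
weakenˡ k = rename (k ↑ʳ_)

size-weakenˡ : ∀ {w m} k (c : Circuit w m) → size (weakenˡ k c) ≡ size c
size-weakenˡ k = size-rename (k ↑ʳ_)

eval-weakenˡ : ∀ {k w m} (c : Circuit w m) (xs : Bits k) (ys : Bits w) →
               eval (weakenˡ k c) (xs ++ ys) ≡ eval c ys
eval-weakenˡ {k} c xs ys = eval-rename (k ↑ʳ_) c (lookup-++ʳ xs ys)

^-distribʳ-* : ∀ m n k → (m * n) ^ k ≡ m ^ k * n ^ k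
^-distribʳ-* m n zero    = refl
^-distribʳ-* m n (suc k) = begin
  m * n * (m * n) ^ k       ≡⟨ cong (m * n *_) (^-distribʳ-* m n k) ⟩
  m * n * (m ^ k * n ^ k)   ≡⟨ interchange m n (m ^ k) (n ^ k) ⟩
  m * m ^ k * (n * n ^ k)   ∎
  where open ≡-Reasoning

m+m≤[2+k]*m : ∀ k m → m + m ≤ (2 + k) * m
m+m≤[2+k]*m k m = +-monoʳ-≤ m (m≤m+n m (k * m))

m≤[2+k]^m : ∀ k m → m ≤ (2 + k) ^ m
m≤[2+k]^m k zero    = z≤n
m≤[2+k]^m k (suc m) =
  ≤-trans (+-mono-≤ (m^n>0 (2 + k) m) (m≤[2+k]^m k m)) (m+m≤[2+k]*m k ((2 + k) ^ m))

+-≤-[2+k]^ : ∀ k {m n} i j → m ≤ (2 + k) ^ i → n ≤ (2 + k) ^ j → m + n ≤ (2 + k) ^ suc (i + j)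
+-≤-[2+k]^ k {m} {n} i j m≤ n≤ = begin
  m + n                                  ≤⟨ +-mono-≤ (≤-trans m≤ (^-monoʳ-≤ (2 + k) (m≤m+n i j)))
                                                      (≤-trans n≤ (^-monoʳ-≤ (2 + k) (m≤n+m j i))) ⟩
  (2 + k) ^ (i + j) + (2 + k) ^ (i + j)  ≤⟨ m+m≤[2+k]*m k ((2 + k) ^ (i + j)) ⟩
  (2 + k) ^ suc (i + j)                  ∎
  where open ≤-Reasoning

c*x^c+c≤[2+x]^[1+3c] : ∀ c x → c * x ^ c + c ≤ (2 + x) ^ suc (c + c + c)
c*x^c+c≤[2+x]^[1+3c] c x = +-≤-[2+k]^ x (c + c) c c*x^c≤ (m≤[2+k]^m x c)
  where
  c*x^c≤ : c * x ^ c ≤ (2 + x) ^ (c + c)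
  c*x^c≤ = ≤-trans (*-mono-≤ (m≤[2+k]^m x c) (^-monoˡ-≤ c (m≤n+m x 2)))
                   (≤-reflexive (sym (^-distribˡ-+-* (2 + x) c c)))

[2+n]^c≤3^c*n^3^c+3^c : ∀ c n → (2 + n) ^ c ≤ 3 ^ c * n ^ (3 ^ c) + 3 ^ c
[2+n]^c≤3^c*n^3^c+3^c c zero    = ≤-trans (^-monoˡ-≤ c (n≤1+n 2)) (m≤n+m (3 ^ c) _)
[2+n]^c≤3^c*n^3^c+3^c c (suc m) = begin
  (2 + suc m) ^ c              ≤⟨ ^-monoˡ-≤ c 3+m≤3*[1+m] ⟩
  (3 * suc m) ^ c              ≡⟨ ^-distribʳ-* 3 (suc m) c ⟩
  3 ^ c * suc m ^ c            ≤⟨ *-monoʳ-≤ (3 ^ c) (^-monoʳ-≤ (suc m) (m≤[2+k]^m 1 c)) ⟩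
  3 ^ c * suc m ^ (3 ^ c)      ≤⟨ m≤m+n _ (3 ^ c) ⟩
  3 ^ c * suc m ^ (3 ^ c) + 3 ^ c  ∎
  where
  open ≤-Reasoning
  3+m≤3*[1+m] : 3 + m ≤ 3 * suc m
  3+m≤3*[1+m] = ≤-trans (+-monoʳ-≤ 3 (m≤n*m m 3)) (≤-reflexive (sym (*-suc 3 m)))

-- Bounds by powers of 2 + n absorb all constants, so they are closed under + and ∘ with
-- only the exponent changing.
PowerBounded : (ℕ → ℕ) → Set
PowerBounded f = Σ ℕ λ e → ∀ n → f n ≤ (2 + n) ^ e

PolyBounded⇒PowerBounded : ∀ {f} → PolyBounded f → PowerBounded f
PolyBounded⇒PowerBounded (c , f≤) = suc (c + c + c) , λ n → ≤-trans (f≤ n) (c*x^c+c≤[2+x]^[1+3c] c n)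

PowerBounded⇒PolyBounded : ∀ {f} → PowerBounded f → PolyBounded f
PowerBounded⇒PolyBounded (e , f≤) = 3 ^ e , λ n → ≤-trans (f≤ n) ([2+n]^c≤3^c*n^3^c+3^c e n)

PowerBounded-+ : ∀ {f g} → PowerBounded f → PowerBounded g → PowerBounded (λ n → f n + g n)
PowerBounded-+ (i , f≤) (j , g≤) = suc (i + j) , λ n → +-≤-[2+k]^ n i j (f≤ n) (g≤ n)

PowerBounded-∘ : ∀ {f g} c → PowerBounded f → (∀ n → g n ≤ c * f n ^ c + c) → PowerBounded g
PowerBounded-∘ {f} {g} c (d , f≤) g≤ = suc (1 + d) * E , λ n → begin
  g n                           ≤⟨ g≤ n ⟩
  c * f n ^ c + c               ≤⟨ c*x^c+c≤[2+x]^[1+3c] c (f n) ⟩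
  (2 + f n) ^ E                 ≤⟨ ^-monoˡ-≤ E (+-≤-[2+k]^ n 1 d (2≤[2+n]^1 n) (f≤ n)) ⟩
  ((2 + n) ^ suc (1 + d)) ^ E   ≡⟨ ^-*-assoc (2 + n) (suc (1 + d)) E ⟩
  (2 + n) ^ (suc (1 + d) * E)   ∎
  where
  open ≤-Reasoning
  E = suc (c + c + c)
  2≤[2+n]^1 : ∀ n → 2 ≤ (2 + n) ^ 1
  2≤[2+n]^1 n = ≤-trans (m≤m+n 2 n) (≤-reflexive (sym (*-identityʳ (2 + n))))

PolyBounded-+ : ∀ {f g} → PolyBounded f → PolyBounded g → PolyBounded (λ n → f n + g n)
PolyBounded-+ f-poly g-poly =
  PowerBounded⇒PolyBounded (PowerBounded-+ (PolyBounded⇒PowerBounded f-poly) (PolyBounded⇒PowerBounded g-poly))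

PolyBounded-∘ : ∀ {f g} c → PolyBounded f → (∀ n → g n ≤ c * f n ^ c + c) → PolyBounded g
PolyBounded-∘ c f-poly g≤ = PowerBounded⇒PolyBounded (PowerBounded-∘ c (PolyBounded⇒PowerBounded f-poly) g≤)

lemma2p8 : (L₁ : Language) (L₂ : PairLanguage) →
           SplitHide L₁ L₂ → EfficientBSM L₂ → EfficientIH L₁
lemma2p8 L₁ L₂ sh bsm = record
  { ρ = ρ ; ℓa = pa ; ℓb = pb
  ; ka = λ n → mA (pa n) (pb n) ; kb = λ n → mB (pa n) (pb n)
  ; ρ-poly = ρ-poly ; ℓa-poly = pa-poly ; ℓb-poly = pb-poly
  ; OA = λ n → Alice (pa n) (pb n) ; OB = λ n → Bob (pa n) (pb n)
  ; QA = A ; QB = B ; D = D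
  ; efficient = PolyBounded-+ (PolyBounded-+ A-poly B-poly) D-poly
  ; correct = D-correct
  ; privateA = privateA ; privateB = privateB
  }
  where
  open SplitHide sh renaming (correct to reduction-correct)
  open EfficientBSM bsm renaming (correct to protocol-correct; efficient to Carol-poly)

  D : (n : ℕ) → Circuit ((n + ρ n) + (mA (pa n) (pb n) + mB (pa n) (pb n))) 1
  D n = weakenˡ (n + ρ n) (Carol (pa n) (pb n))

  D-poly : PolyBounded (λ n → size (D n))
  D-poly = let c , Carol≤ = Carol-poly in
    PolyBounded-∘ c (PolyBounded-+ pa-poly pb-poly)
      λ n → ≤-trans (≤-reflexive (size-weakenˡ (n + ρ n) (Carol (pa n) (pb n)))) (Carol≤ (pa n) (pb n))

  D-correct : ∀ n (z : Bits n) (r : Bits (ρ n)) →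
              head (eval (D n) ((z ++ r) ++ (Alice _ _ (a n z r) ++ Bob _ _ (b n z r)))) ≡ L₁ n z
  D-correct n z r = begin
    head (eval (D n) ((z ++ r) ++ messages))        ≡⟨ cong head (eval-weakenˡ (Carol (pa n) (pb n)) (z ++ r) messages) ⟩
    head (eval (Carol (pa n) (pb n)) messages)      ≡⟨ protocol-correct (pa n) (pb n) (a n z r) (b n z r) ⟩
    L₂ (pa n) (pb n) (a n z r) (b n z r)            ≡⟨ sym (reduction-correct n z r) ⟩
    L₁ n z                                          ∎
    where
    open ≡-Reasoning
    messages = Alice (pa n) (pb n) (a n z r) ++ Bob (pa n) (pb n) (b n z r)
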